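{- For all natural numbers $p$ and $q$ there is a number $C=C(p,q)$ such that the following holds: whenever a graph $G$ contains two families of vertex sets $\mathcal{A}=\{V_1,\ldots,V_C\}$ and $\mathcal{B}=\{W_1,\ldots,W_C\}$, where all $2C$ sets are pairwise disjoint and each has exactly $p$ vertices, and for every $V_i\in\mathcal{A}$ and every $W_j\in\mathcal{B}$ there is at least one edge of $G$ with one endpoint in $V_i$ and the other in $W_j$, then $G$ contains the complete bipartite graph $K_{q,q}$ as a (not necessarily induced) subgraph.
   Context: All graphs are finite, simple, undirected. -}

module Defs where

open import Level using (0ℓ)
open import Data.Nat using (ℕ)
open import Data.Fin using (Fin)
open import Data.Bool using (Bool; true; false)
open import Data.Product using (_×_; Σ; ∃; ∃-syntax; _,_)
open import Relation.Nullary using (¬_)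
open import Relation.Binary.PropositionalEquality using (_≡_)
open import Function.Definitions using (Injective)

record Graph (n : ℕ) : Set₁ where
  field
    Adj   : Fin n → Fin n → Set
    sym   : ∀ {x y} → Adj x y → Adj y x
    irrefl : ∀ {x} → ¬ Adj x x
open Graph public

-- Two families of C vertex sets of size p each, all 2C sets pairwise
-- disjoint: encoded as a single injective labelling.  The Bool picks the
-- family (false = 𝒜 = V_i, true = ℬ = W_j), Fin C the index of the set,
-- Fin p enumerates the p distinct vertices of that set.
Families : ℕ → ℕ → ℕ → Set
Families n C p = Σ (Bool × Fin C × Fin p → Fin n)
                   (Injective _≡_ _≡_)

setV : ∀ {n C p} → Families n C p → Fin C → Fin p → Fin n
setV (f , _) i k = f (false , i , k)

setW : ∀ {n C p} → Families n C p → Fin C → Fin p → Fin n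
setW (f , _) j k = f (true , j , k)

AllPairsLinked : ∀ {n C p} → Graph n → Families n C p → Set
AllPairsLinked {C = C} {p} G F =
  (i j : Fin C) → ∃[ k ] ∃[ l ] Adj G (setV F i k) (setW F j l)

ContainsKqq : ∀ {n} → Graph n → ℕ → Set
ContainsKqq {n} G q =
  Σ (Bool × Fin q → Fin n) λ φ →
    Injective _≡_ _≡_ φ ×
    ((i j : Fin q) → Adj G (φ (false , i)) (φ (true , j)))

-- Choose one linking edge for every pair (V_i, W_j) and colour the grid cell (i, j) by the pair of
-- positions of its endpoints inside V_i and W_j, a colour in Fin p × Fin p.  Two pigeonhole steps give a
-- (q × q)-subgrid on which the V-position depends only on the row and the W-position is constant;
-- then for each row its V-vertex is adjacent to the common W-vertex of every column, a K_{q,q}.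
-- First pigeonhole the columns by their whole colour vector on 1 + pq fixed rows, then those rows
-- by the W-position.
module Submission where

open import Defs hiding (sym)
open import Data.Bool using (Bool; true; false)
open import Data.Fin using (Fin; _↑ˡ_; inject≤; combine; remQuot; funToFin; finToFun)
open import Data.Fin.Properties using (↑ˡ-injective; inject≤-injective; remQuot-combine; finToFun-funToFin)
open import Data.List using (List; []; _∷_; length; lookup; filter; allFin)
open import Data.List.Properties using (length-tabulate)
open import Data.List.Membership.Propositional using (_∈_)
open import Data.List.Membership.Propositional.Properties using (∈-lookup; ∈-allFin)
open import Data.List.Relation.Unary.All as All using (All; []; _∷_)
open import Data.List.Relation.Unary.All.Properties using (all-filter; filter⁺)
open import Data.List.Relation.Unary.AllPairs using (_∷_)
open import Data.List.Relation.Unary.Any using (here; there)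
open import Data.List.Relation.Unary.Unique.Propositional using (Unique)
open import Data.List.Relation.Unary.Unique.Propositional.Properties as Unique using (allFin⁺)
open import Data.Nat using (ℕ; zero; suc; _+_; _*_; _^_; _≤_; _<_; _<?_)
open import Data.Nat.Properties using (+-suc; +-cancelˡ-<; +-monoˡ-≤; ≮⇒≥; ≤-refl; m≤n+m; module ≤-Reasoning)
open import Data.Product using (Σ-syntax; ∃-syntax; _×_; _,_; proj₁; proj₂)
open import Data.Empty using (⊥-elim)
open import Function using (id)
open import Function.Definitions using (Injective)
open import Relation.Binary.Definitions using (DecidableEquality)
open import Relation.Binary.PropositionalEquality using (_≡_; _≢_; refl; sym; trans; cong; subst₂; module ≡-Reasoning)
open import Relation.Nullary using (Dec; yes; no)
open import Relation.Unary using (Decidable)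
open import Relation.Unary.Properties using (∁?)

length-filter+length-filter-∁ : ∀ {A : Set} {P : A → Set} (P? : Decidable P) (xs : List A) →
  length (filter P? xs) + length (filter (∁? P?) xs) ≡ length xs
length-filter+length-filter-∁ P? [] = refl
length-filter+length-filter-∁ P? (x ∷ xs) with P? x
... | yes _ = cong suc (length-filter+length-filter-∁ P? xs)
... | no _  = trans (+-suc _ _) (cong suc (length-filter+length-filter-∁ P? xs))

lookup-injective : ∀ {A : Set} {xs : List A} → Unique xs → Injective _≡_ _≡_ (lookup xs)
lookup-injective (_ ∷ _) {Fin.zero} {Fin.zero} _ = refl
lookup-injective (x∉xs ∷ _) {Fin.zero} {Fin.suc j} eq = ⊥-elim (All.lookup x∉xs (∈-lookup j) eq)
lookup-injective (x∉xs ∷ _) {Fin.suc i} {Fin.zero} eq = ⊥-elim (All.lookup x∉xs (∈-lookup i) (sym eq))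
lookup-injective (_ ∷ xs!) {Fin.suc i} {Fin.suc j} eq = cong Fin.suc (lookup-injective xs! eq)

Unique⇒injection : ∀ {A : Set} {P : A → Set} {xs : List A} M → Unique xs → All P xs → M < length xs →
  Σ[ g ∈ (Fin (suc M) → A) ] Injective _≡_ _≡_ g × (∀ i → P (g i))
Unique⇒injection {xs = xs} M xs! pxs M<|xs| =
  (λ i → lookup xs (inject≤ i M<|xs|)) ,
  (λ eq → inject≤-injective M<|xs| M<|xs| _ _ (lookup-injective xs! eq)) ,
  (λ i → All.lookup pxs (∈-lookup _))

module _ {A B : Set} (_≟_ : DecidableEquality B) (f : A → B) where

  pigeonhole-Unique : ∀ M (cs : List B) (xs : List A) → All (λ x → f x ∈ cs) xs → Unique xs →
    length cs * M < length xs →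
    ∃[ c ] ∃[ ys ] Unique ys × All (λ x → f x ≡ c) ys × M < length ys
  pigeonhole-Unique M [] (x ∷ xs) (() ∷ _) _ _
  pigeonhole-Unique M (c ∷ cs) xs f∈c∷cs xs! bound = by-size-of-hits (M <? length hits)
    where
    hit? : Decidable (λ x → f x ≡ c)
    hit? x = f x ≟ c
    hits misses : List A
    hits = filter hit? xs
    misses = filter (∁? hit?) xs

    drop-c : ∀ {x} → f x ∈ c ∷ cs × f x ≢ c → f x ∈ cs
    drop-c (here eq , neq) = ⊥-elim (neq eq)
    drop-c (there m , _) = m

    large-misses : length hits ≤ M → length cs * M < length misses
    large-misses |hits|≤M = +-cancelˡ-< M _ _ (begin-strict
      M + length cs * M             <⟨ bound ⟩
      length xs                     ≡⟨ length-filter+length-filter-∁ hit? xs ⟨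
      length hits + length misses   ≤⟨ +-monoˡ-≤ _ |hits|≤M ⟩
      M + length misses             ∎)
      where open ≤-Reasoning

    by-size-of-hits : Dec (M < length hits) →
      ∃[ c ] ∃[ ys ] Unique ys × All (λ x → f x ≡ c) ys × M < length ys
    by-size-of-hits (yes M<|hits|) = c , hits , Unique.filter⁺ hit? xs! , all-filter hit? xs , M<|hits|
    by-size-of-hits (no M≮|hits|) = pigeonhole-Unique M cs misses
      (All.zipWith drop-c (filter⁺ (∁? hit?) f∈c∷cs , all-filter (∁? hit?) xs))
      (Unique.filter⁺ (∁? hit?) xs!)
      (large-misses (≮⇒≥ M≮|hits|))

pigeonhole-injection : ∀ {N b} M (f : Fin N → Fin b) → b * M < N →
  ∃[ c ] Σ[ g ∈ (Fin (suc M) → Fin N) ] Injective _≡_ _≡_ g × (∀ i → f (g i) ≡ c)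
pigeonhole-injection {N} {b} M f bM<N
  with c , ys , ys! , f≡c , M<|ys| ← pigeonhole-Unique Data.Fin._≟_ f M (allFin b) (allFin N)
         (All.tabulate (λ {x} _ → ∈-allFin (f x))) (allFin⁺ N)
         (subst₂ (λ |cs| |xs| → |cs| * M < |xs|)
                 (sym (length-tabulate {n = b} id)) (sym (length-tabulate {n = N} id)) bM<N)
  = c , Unique⇒injection M ys! f≡c M<|ys|

equal-columns : ∀ {R N d} M (χ : Fin R → Fin N → Fin d) → d ^ R * M < N →
  ∃[ κ ] Σ[ g ∈ (Fin (suc M) → Fin N) ] Injective _≡_ _≡_ g × (∀ r t → χ r (g t) ≡ κ r)
-- A column is coded by its colour vector in Fin (d ^ R); columns with equal codes have equal colours.
equal-columns M χ bound
  with c , g , g-inj , column≡c ← pigeonhole-injection M (λ j → funToFin (λ r → χ r j)) bound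
  = finToFun c , g , g-inj ,
    λ r t → trans (sym (finToFun-funToFin (λ r → χ r (g t)) r)) (cong (λ c → finToFun c r) (column≡c t))

record UniformSubgrid {R N p : ℕ} (q : ℕ) (χ : Fin R → Fin N → Fin p × Fin p) : Set where
  field
    row              : Fin q → Fin R
    column           : Fin q → Fin N
    row-injective    : Injective _≡_ _≡_ row
    column-injective : Injective _≡_ _≡_ column
    rowColour        : Fin q → Fin p
    columnColour     : Fin p
    uniform          : ∀ s t → χ (row s) (column t) ≡ (rowColour s , columnColour)

uniformSubgrid : ∀ {N p} q (χ : Fin (suc (p * q)) → Fin N → Fin p × Fin p) →
  (p * p) ^ suc (p * q) * q < N → UniformSubgrid (suc q) χ
uniformSubgrid {p = p} q χ bound
  with colour , κ , κ-inj , χ≡colour ←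
         equal-columns q (λ r j → combine (proj₁ (χ r j)) (proj₂ (χ r j))) bound
  with b , ρ , ρ-inj , colour₂≡b ←
         pigeonhole-injection q (λ r → proj₂ (remQuot {p} p (colour r))) ≤-refl
  = record
  { row = ρ ; column = κ ; row-injective = ρ-inj ; column-injective = κ-inj
  ; rowColour = λ s → proj₁ (remQuot {p} p (colour (ρ s))) ; columnColour = b
  ; uniform = λ s t → begin
      χ (ρ s) (κ t)
        ≡⟨ remQuot-combine (proj₁ (χ (ρ s) (κ t))) _ ⟨
      remQuot {p} p (combine (proj₁ (χ (ρ s) (κ t))) _)
        ≡⟨ cong (remQuot {p} p) (χ≡colour (ρ s) t) ⟩
      remQuot {p} p (colour (ρ s))
        ≡⟨ cong (proj₁ (remQuot {p} p (colour (ρ s))) ,_) (colour₂≡b s) ⟩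
      (proj₁ (remQuot {p} p (colour (ρ s))) , b)
        ∎ }
  where open ≡-Reasoning

bipartite-pick : ∀ {n C p q} → Families n C p →
  (Fin q → Fin C) → (Fin q → Fin p) → (Fin q → Fin C) → (Fin q → Fin p) → Bool × Fin q → Fin n
bipartite-pick F ρ x κ y (false , s) = setV F (ρ s) (x s)
bipartite-pick F ρ x κ y (true , t)  = setW F (κ t) (y t)

bipartite-pick-injective : ∀ {n C p q} (F : Families n C p) {ρ κ : Fin q → Fin C} (x y : Fin q → Fin p) →
  Injective _≡_ _≡_ ρ → Injective _≡_ _≡_ κ → Injective _≡_ _≡_ (bipartite-pick F ρ x κ y)
bipartite-pick-injective (f , f-inj) x y ρ-inj κ-inj {false , s} {false , s′} eq =
  cong (false ,_) (ρ-inj (cong (λ z → proj₁ (proj₂ z)) (f-inj eq)))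
bipartite-pick-injective (f , f-inj) x y ρ-inj κ-inj {true , t} {true , t′} eq =
  cong (true ,_) (κ-inj (cong (λ z → proj₁ (proj₂ z)) (f-inj eq)))
bipartite-pick-injective (f , f-inj) x y ρ-inj κ-inj {false , s} {true , t} eq with () ← f-inj eq
bipartite-pick-injective (f , f-inj) x y ρ-inj κ-inj {true , t} {false , s} eq with () ← f-inj eq

lemma1 : (p q : ℕ) → ∃[ C ] ((n : ℕ) (G : Graph n) (F : Families n C p) →
           AllPairsLinked G F → ContainsKqq G q)
lemma1 p zero = 0 , λ _ _ _ _ → (λ { (_ , ()) }) , (λ { {_ , ()} }) , λ ()
lemma1 p (suc q) = R + suc ((p * p) ^ R * q) , Kqq
  where
  R = suc (p * q)
  Kqq : (n : ℕ) (G : Graph n) (F : Families n (R + suc ((p * p) ^ R * q)) p) →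
        AllPairsLinked G F → ContainsKqq G (suc q)
  Kqq n G F linked =
    bipartite-pick F (λ s → row s ↑ˡ _) rowColour column (λ _ → columnColour) ,
    bipartite-pick-injective F _ _ (λ eq → row-injective (↑ˡ-injective _ _ _ eq)) column-injective ,
    λ s t → subst₂ (λ k l → Adj G (setV F (row s ↑ˡ _) k) (setW F (column t) l))
                   (cong proj₁ (uniform s t)) (cong proj₂ (uniform s t))
                   (proj₂ (proj₂ (linked (row s ↑ˡ _) (column t))))
    where
    endpoints : Fin R → Fin (R + suc ((p * p) ^ R * q)) → Fin p × Fin p
    endpoints i j = proj₁ (linked (i ↑ˡ _) j) , proj₁ (proj₂ (linked (i ↑ˡ _) j))
    open UniformSubgrid (uniformSubgrid q endpoints (m≤n+m _ R))
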